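{- For every integer $k \geq 3$, let $G$ be the tree constructed as follows. Take a vertex $v_0$ adjacent to three vertices $v_1, v_2, v_3$ (and to no other vertices). Attach to $v_1$ one pendant path with four vertices (new vertices $a_1,a_2,a_3,a_4$ with edges $v_1a_1, a_1a_2, a_2a_3, a_3a_4$) and two pendant paths with two vertices each; attach to $v_2$ exactly $k$ pendant paths with two vertices each, and to $v_3$ exactly $k+2$ pendant paths with two vertices each. Here attaching a pendant path $a b$ (a copy of $K_2$) to $v_i$ means adding new vertices $a, b$ and edges $v_i a$ and $a b$. Then the independence polynomial of $G$ is not log-concave.
   Context: An independent set in a graph is a set of pairwise non-adjacent vertices; $\alpha(G)$ denotes the maximum size of an independent set. The independence polynomial of $G$ is $I(G;x)=\sum_{k=0}^{\alpha(G)} s_k x^k$, where $s_k$ is the number of independent sets of size $k$ in $G$. A polynomial $\sum_{k=0}^{n} a_k x^k$ is called log-concave if its coefficient sequence satisfies $a_k^2 \geq a_{k-1}a_{k+1}$ for all $k\in\{1,\dots,n-1\}$. -}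

module Defs where

open import Data.Nat using (ℕ; zero; suc; _+_; _*_; _∸_; _^_; _≤_; _<_; _⊔_)
open import Data.Bool using (Bool; true; false; _∧_; _∨_; not; if_then_else_)
open import Data.List using (List; []; _∷_; _++_; map; length; foldr; filter; upTo; concatMap)
open import Data.Vec using (Vec; []; _∷_)
open import Data.Product using (_×_; _,_; proj₁; proj₂)
open import Data.Nat using (_≡ᵇ_)

-- A finite simple graph on the vertex set {0, …, n-1}, given by its list of edges
-- (unordered: an edge (u , v) joins u and v).
record Graph : Set where
  constructor mkGraph
  field
    nVert : ℕ
    edges : List (ℕ × ℕ)
open Graph public

Subset : ℕ → Set
Subset n = Vec Bool n

-- membership of vertex i (false if out of range)
_∈ₛ_ : {n : ℕ} → ℕ → Subset n → Bool
_ ∈ₛ [] = false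
zero ∈ₛ (b ∷ _) = b
suc i ∈ₛ (_ ∷ s) = i ∈ₛ s

card : {n : ℕ} → Subset n → ℕ
card [] = 0
card (true ∷ s) = suc (card s)
card (false ∷ s) = card s

allSubsets : (n : ℕ) → List (Subset n)
allSubsets zero = [] ∷ []
allSubsets (suc n) = map (false ∷_) (allSubsets n) ++ map (true ∷_) (allSubsets n)

isIndependent : (G : Graph) → Subset (nVert G) → Bool
isIndependent G S = foldr (λ e acc → not ((proj₁ e ∈ₛ S) ∧ (proj₂ e ∈ₛ S)) ∧ acc) true (edges G)

independentSets : (G : Graph) → List (Subset (nVert G))
independentSets G = filter (λ S → Data.Bool.T? (isIndependent G S)) (allSubsets (nVert G))
  where import Data.Bool

s : Graph → ℕ → ℕ
s G k = length (filter (λ S → Data.Nat._≟_ (card S) k) (independentSets G))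
  where import Data.Nat

α : Graph → ℕ
α G = foldr (λ S m → card S ⊔ m) 0 (independentSets G)

indPoly : Graph → List ℕ
indPoly G = map (s G) (upTo (suc (α G)))

-- k-th entry of a coefficient list (0 beyond the end)
coeff : List ℕ → ℕ → ℕ
coeff [] _ = 0
coeff (a ∷ _) zero = a
coeff (_ ∷ as) (suc k) = coeff as k

LogConcave : List ℕ → Set
LogConcave as = (k : ℕ) → 1 ≤ k → suc k < length as →
  coeff as (k ∸ 1) * coeff as (suc k) ≤ coeff as k ^ 2

-- Vertex numbering: v0 = 0, v1 = 1, v2 = 2, v3 = 3,
-- a1..a4 = 4..7 (pendant P4 at v1), pendant P2's at v1: 8-9, 10-11,
-- k pendant P2's at v2: (12+2i, 13+2i) for i < k,
-- k+2 pendant P2's at v3: (12+2k+2j, 13+2k+2j) for j < k+2.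
-- Total number of vertices: 16 + 4k.

pendantP2s : (r base m : ℕ) → List (ℕ × ℕ)
pendantP2s r base m =
  concatMap (λ i → (r , base + 2 * i) ∷ (base + 2 * i , suc (base + 2 * i)) ∷ []) (upTo m)

treeG : ℕ → Graph
treeG k = mkGraph (16 + 4 * k)
  ( (0 , 1) ∷ (0 , 2) ∷ (0 , 3)
  ∷ (1 , 4) ∷ (4 , 5) ∷ (5 , 6) ∷ (6 , 7)
  ∷ pendantP2s 1 8 2
  ++ pendantP2s 2 12 k
  ++ pendantP2s 3 (12 + 2 * k) (k + 2))

module Submission where

-- The complement of an independent set is a vertex cover, so the top coefficients
-- s_α, s_{α-1}, s_{α-2} of I(G) are the three lowest coefficients of the vertex-cover
-- polynomial. Once the cover status of v₂ and v₃ is fixed, a vertex cover splits into a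
-- cover of the ten other vertices near the root (finitely many, counted by evaluation)
-- and independent choices on the pendant paths ab at v₂ and v₃: a path at a covered root
-- contributes x(2 + x), one at an uncovered root x(1 + x). Reading off the low
-- coefficients gives s_{9+2k} = 1, s_{8+2k} = 5·2^k + 2k + 19 and
-- s_{7+2k} ≥ 52·4^k + O(k·2^k); the leading term beats (5·2^k)² = 25·4^k, and for k ≥ 3
-- the lower-order terms do not change that.

open import Defs
open import Data.Bool using (Bool; true; false; _∧_; not; if_then_else_; T?)
open import Data.Bool.Properties using (∧-assoc)
open import Data.Nat using (ℕ; zero; suc; _+_; _*_; _^_; _<_; _≤_; _⊔_; z≤n; s≤s; _≟_)
open import Data.Nat.Properties
  using ( +-comm; +-suc; +-identityʳ; *-comm; *-identityʳ; suc-injective; ^-distribˡ-+-*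
        ; ≤-refl; ≤-reflexive; ≤-trans; <-trans; n<1+n; n≤1+n; m≤m+n; m≤n+m; m≤m⊔n; m≤n⊔m
        ; +-mono-≤; *-mono-≤; *-monoʳ-≤; *-monoˡ-≤; <⇒≱; m≤n⇒∃[o]m+o≡n; *-zeroʳ
        ; *-distribʳ-+; module ≤-Reasoning)
open import Data.Nat.Tactic.RingSolver using (solve-∀)
open import Data.List using (List; []; _∷_; _++_; map; filter; length; foldr; concatMap; applyUpTo; upTo)
open import Data.List.Properties
  using (filter-++; filter-≐; filter-reject; length-++; length-map; length-applyUpTo; concatMap-map; map-upTo)
open import Data.Vec using ([]; _∷_)
import Data.Vec as Vec
import Data.Vec.Properties as Vec
open import Data.Product using (_×_; _,_; proj₁; proj₂)
open import Function using (_∘_)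
open import Relation.Nullary using (¬_; Dec; does; yes; no)
open import Relation.Binary.PropositionalEquality
  using (_≡_; refl; sym; trans; cong; cong₂; subst; subst₂; _≗_; module ≡-Reasoning)

-- Polynomials with coefficients in ℕ, as coefficient functions

one : ℕ → ℕ
one zero    = 1
one (suc _) = 0

shift : (ℕ → ℕ) → ℕ → ℕ
shift f zero    = 0
shift f (suc j) = f j

shiftBy : ℕ → (ℕ → ℕ) → ℕ → ℕ
shiftBy zero    f = f
shiftBy (suc m) f = shift (shiftBy m f)

infixl 7 _⊛_
_⊛_ : (ℕ → ℕ) → (ℕ → ℕ) → ℕ → ℕ
(f ⊛ g) zero    = f 0 * g 0
(f ⊛ g) (suc j) = f 0 * g (suc j) + ((f ∘ suc) ⊛ g) j

bitSum : (Bool → ℕ → ℕ) → ℕ → ℕ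
bitSum F j = F false j + shift (F true) j

shift-cong : ∀ {f g} → f ≗ g → shift f ≗ shift g
shift-cong f≗g zero    = refl
shift-cong f≗g (suc j) = f≗g j

shiftBy-cong : ∀ m {f g} → f ≗ g → shiftBy m f ≗ shiftBy m g
shiftBy-cong zero    f≗g = f≗g
shiftBy-cong (suc m) f≗g = shift-cong (shiftBy-cong m f≗g)

shiftBy-+ : ∀ m h i → shiftBy m h (m + i) ≡ h i
shiftBy-+ zero    h i = refl
shiftBy-+ (suc m) h i = shiftBy-+ m h i

⊛-cong : ∀ {f f′ g g′} → f ≗ f′ → g ≗ g′ → f ⊛ g ≗ f′ ⊛ g′
⊛-cong f≗ g≗ zero    = cong₂ _*_ (f≗ 0) (g≗ 0)
⊛-cong f≗ g≗ (suc j) = cong₂ _+_ (cong₂ _*_ (f≗ 0) (g≗ (suc j))) (⊛-cong (f≗ ∘ suc) g≗ j)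

zero-⊛ : ∀ g → (λ _ → 0) ⊛ g ≗ λ _ → 0
zero-⊛ g zero    = refl
zero-⊛ g (suc j) = zero-⊛ g j

one-⊛ : ∀ g → one ⊛ g ≗ g
one-⊛ g zero    = +-identityʳ (g 0)
one-⊛ g (suc j) = trans (cong (g (suc j) + 0 +_) (zero-⊛ g j))
                        (trans (+-identityʳ _) (+-identityʳ (g (suc j))))

shift-⊛ : ∀ f g → shift f ⊛ g ≗ shift (f ⊛ g)
shift-⊛ f g zero    = refl
shift-⊛ f g (suc j) = refl

⊛-shift : ∀ f g → f ⊛ shift g ≗ shift (f ⊛ g)
⊛-shift f g zero          = *-zeroʳ (f 0)
⊛-shift f g (suc zero)    = trans (cong (f 0 * g 0 +_) (*-zeroʳ (f 1))) (+-identityʳ _)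
⊛-shift f g (suc (suc j)) = cong (f 0 * g (suc j) +_) (⊛-shift (f ∘ suc) g (suc j))

shiftBy-⊛ : ∀ m f g → shiftBy m f ⊛ g ≗ shiftBy m (f ⊛ g)
shiftBy-⊛ zero    f g j = refl
shiftBy-⊛ (suc m) f g j = trans (shift-⊛ (shiftBy m f) g j) (shift-cong (shiftBy-⊛ m f g) j)

⊛-shiftBy : ∀ m f g → f ⊛ shiftBy m g ≗ shiftBy m (f ⊛ g)
⊛-shiftBy zero    f g j = refl
⊛-shiftBy (suc m) f g j = trans (⊛-shift f (shiftBy m g) j) (shift-cong (⊛-shiftBy m f g) j)

⊛-shiftBy²-+ : ∀ a b f g i → (f ⊛ shiftBy a (shiftBy b g)) (i + (a + b)) ≡ (f ⊛ g) i
⊛-shiftBy²-+ a b f g i = begin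
  (f ⊛ shiftBy a (shiftBy b g)) (i + (a + b)) ≡⟨ cong (f ⊛ shiftBy a (shiftBy b g)) (reassoc i a b) ⟩
  (f ⊛ shiftBy a (shiftBy b g)) (a + (b + i)) ≡⟨ ⊛-shiftBy a f (shiftBy b g) (a + (b + i)) ⟩
  shiftBy a (f ⊛ shiftBy b g) (a + (b + i))   ≡⟨ shiftBy-+ a (f ⊛ shiftBy b g) (b + i) ⟩
  (f ⊛ shiftBy b g) (b + i)                   ≡⟨ ⊛-shiftBy b f g (b + i) ⟩
  shiftBy b (f ⊛ g) (b + i)                   ≡⟨ shiftBy-+ b (f ⊛ g) i ⟩
  (f ⊛ g) i                                   ∎
  where
  open ≡-Reasoning
  reassoc : ∀ i a b → i + (a + b) ≡ a + (b + i)
  reassoc = solve-∀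

⊛-distribʳ-+ : ∀ f g h → (λ j → f j + g j) ⊛ h ≗ (λ j → (f ⊛ h) j + (g ⊛ h) j)
⊛-distribʳ-+ f g h zero    = *-distribʳ-+ (h 0) (f 0) (g 0)
⊛-distribʳ-+ f g h (suc j) =
  trans (cong ((f 0 + g 0) * h (suc j) +_) (⊛-distribʳ-+ (f ∘ suc) (g ∘ suc) h j))
        (interchange (f 0) (g 0) (h (suc j)) _ _)
  where
  interchange : ∀ a b c d e → (a + b) * c + (d + e) ≡ (a * c + d) + (b * c + e)
  interchange = solve-∀

bitSum-cong : ∀ {F G} → (∀ b → F b ≗ G b) → bitSum F ≗ bitSum G
bitSum-cong F≗G j = cong₂ _+_ (F≗G false j) (shift-cong (F≗G true) j)

bitSum-⊛ : ∀ F g → bitSum F ⊛ g ≗ bitSum (λ b → F b ⊛ g)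
bitSum-⊛ F g j = trans (⊛-distribʳ-+ (F false) (shift (F true)) g j)
                       (cong ((F false ⊛ g) j +_) (shift-⊛ (F true) g j))

bitSum-comm : ∀ (F : Bool → Bool → ℕ → ℕ) →
  bitSum (λ a → bitSum (λ b → F a b)) ≗ bitSum (λ b → bitSum (λ a → F a b))
bitSum-comm F zero    = refl
bitSum-comm F (suc j) = interchange (F false false (suc j)) (F false true j) (F true false j) _
  where
  interchange : ∀ a b c d → (a + b) + (c + d) ≡ (a + c) + (b + d)
  interchange = solve-∀

bitSum-reorder : ∀ (F : Bool → Bool → Bool → Bool → ℕ → ℕ) →
  bitSum (λ a → bitSum (λ b → bitSum (λ c → bitSum (λ d → F a b c d)))) ≗
  bitSum (λ c → bitSum (λ d → bitSum (λ a → bitSum (λ b → F a b c d))))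
bitSum-reorder F j =
  trans (bitSum-cong (λ a → bitSum-comm (λ b c → bitSum (λ d → F a b c d))) j)
  (trans (bitSum-cong (λ a → bitSum-cong (λ c → bitSum-comm (λ b d → F a b c d))) j)
  (trans (bitSum-comm (λ a c → bitSum (λ d → bitSum (λ b → F a b c d))) j)
         (bitSum-cong (λ c → bitSum-comm (λ a d → bitSum (λ b → F a b c d))) j)))

bitSum²-+ : ∀ N {F G : Bool → Bool → ℕ → ℕ} → (∀ c d i → F c d (i + N) ≡ G c d i) →
  ∀ i → bitSum (λ c → bitSum (F c)) (2 + i + N) ≡ bitSum (λ c → bitSum (G c)) (2 + i)
bitSum²-+ N F≡G i = cong₂ _+_ (cong₂ _+_ (F≡G false false (2 + i)) (F≡G false true (1 + i)))
                              (cong₂ _+_ (F≡G true false (1 + i)) (F≡G true true i))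

-- Counting subsets by size

count : (n : ℕ) → (Subset n → Bool) → ℕ → ℕ
count zero    P = if P [] then one else λ _ → 0
count (suc n) P = bitSum (λ b → count n (λ v → P (b ∷ v)))

complement : ∀ {n} → Subset n → Subset n
complement = Vec.map not

count-cong : ∀ n {P Q} → (∀ v → P v ≡ Q v) → count n P ≗ count n Q
count-cong zero    P≡Q j = cong (λ b → (if b then one else λ _ → 0) j) (P≡Q [])
count-cong (suc n) P≡Q   = bitSum-cong (λ b → count-cong n (λ v → P≡Q (b ∷ v)))

count-false : ∀ n → count n (λ _ → false) ≗ λ _ → 0
count-false zero    j       = refl
count-false (suc n) zero    = cong (_+ 0) (count-false n zero)
count-false (suc n) (suc j) = cong₂ _+_ (count-false n (suc j)) (count-false n j)

count-beyond : ∀ n P {j} → n < j → count n P j ≡ 0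
count-beyond zero    P {suc j} _ with P []
... | true  = refl
... | false = refl
count-beyond (suc n) P {suc j} (s≤s n<j) =
  cong₂ _+_ (count-beyond n _ (<-trans n<j (n<1+n j))) (count-beyond n _ n<j)

count-complement : ∀ n P {j i} → j + i ≡ n → count n P j ≡ count n (λ v → P (complement v)) i
count-complement zero    P {zero} {zero} refl = refl
count-complement (suc n) P {j} {i} eq =
  trans (cong₂ _+_ (shiftedʳ (λ v → P (false ∷ v)) eq) (shiftedˡ (λ v → P (true ∷ v)) eq))
        (+-comm _ (count n (λ v → P (true ∷ complement v)) i))
  where
  shiftedʳ : ∀ Q {j i} → j + i ≡ suc n → count n Q j ≡ shift (count n (λ v → Q (complement v))) i
  shiftedʳ Q {j} {zero}  eq = count-beyond n Q (≤-reflexive (sym (trans (sym (+-identityʳ j)) eq)))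
  shiftedʳ Q {j} {suc i} eq = count-complement n Q (suc-injective (trans (sym (+-suc j i)) eq))
  shiftedˡ : ∀ Q {j i} → j + i ≡ suc n → shift (count n Q) j ≡ count n (λ v → Q (complement v)) i
  shiftedˡ Q {zero}  refl = sym (count-beyond n _ (n<1+n n))
  shiftedˡ Q {suc j} eq   = count-complement n Q (suc-injective eq)

infixr 6 _⊗_
_⊗_ : ∀ {m n} → (Subset m → Bool) → (Subset n → Bool) → Subset (m + n) → Bool
_⊗_ {zero}  P Q v       = P [] ∧ Q v
_⊗_ {suc m} P Q (b ∷ v) = ((λ u → P (b ∷ u)) ⊗ Q) v

⊗-++ : ∀ {m n} (P : Subset m → Bool) (Q : Subset n → Bool) u w → (P ⊗ Q) (u Vec.++ w) ≡ P u ∧ Q w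
⊗-++ P Q []      w = refl
⊗-++ P Q (b ∷ u) w = ⊗-++ (λ u → P (b ∷ u)) Q u w

count-⊗ : ∀ m {n} (P : Subset m → Bool) (Q : Subset n → Bool) →
          count (m + n) (P ⊗ Q) ≗ count m P ⊛ count n Q
count-⊗ zero {n} P Q j with P []
... | true  = sym (one-⊛ (count n Q) j)
... | false = trans (count-false n j) (sym (zero-⊛ (count n Q) j))
count-⊗ (suc m) {n} P Q j =
  trans (bitSum-cong (λ b → count-⊗ m (λ u → P (b ∷ u)) Q) j)
        (sym (bitSum-⊛ (λ b → count m (λ u → P (b ∷ u))) (count n Q) j))

swapPairs : ∀ {n} → Subset (4 + n) → Subset (4 + n)
swapPairs (c ∷ d ∷ a ∷ b ∷ v) = a ∷ b ∷ c ∷ d ∷ v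

count-swapPairs : ∀ n P →
  count (4 + n) P ≗ bitSum (λ c → bitSum (λ d → count (2 + n) (λ v → P (swapPairs (c ∷ d ∷ v)))))
count-swapPairs n P = bitSum-reorder (λ a b c d → count n (λ v → P (a ∷ b ∷ c ∷ d ∷ v)))

filter-map : ∀ {A B : Set} {P : B → Set} (P? : ∀ y → Dec (P y)) (f : A → B) xs →
             filter P? (map f xs) ≡ map f (filter (λ x → P? (f x)) xs)
filter-map P? f []       = refl
filter-map P? f (x ∷ xs) with does (P? (f x))
... | true  = cong (f x ∷_) (filter-map P? f xs)
... | false = filter-map P? f xs

sizedSubsets : ∀ {n} → (Subset n → Bool) → ℕ → List (Subset n) → List (Subset n)
sizedSubsets P j xs = filter (λ S → card S ≟ j) (filter (λ S → T? (P S)) xs)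

length-sizedSubsets-map : ∀ {n} P j b (xs : List (Subset n)) →
  length (sizedSubsets P j (map (b ∷_) xs)) ≡
  length (filter (λ v → card (b ∷ v) ≟ j) (filter (λ v → T? (P (b ∷ v))) xs))
length-sizedSubsets-map {n} P j b xs =
  trans (cong (length ∘ filter _) (filter-map (λ S → T? (P S)) (b ∷_) xs))
  (trans (cong length (filter-map (λ S → card S ≟ j) (b ∷_) accepted))
         (length-map (λ (v : Subset n) → b ∷ v) (filter (λ v → card (b ∷ v) ≟ j) accepted)))
  where accepted = filter (λ v → T? (P (b ∷ v))) xs

length-sizedSubsets : ∀ n P j → length (sizedSubsets P j (allSubsets n)) ≡ count n P j
length-sizedSubsets zero P j with P []
length-sizedSubsets zero P zero    | true  = refl
length-sizedSubsets zero P (suc j) | true  = refl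
length-sizedSubsets zero P j       | false = refl
length-sizedSubsets (suc n) P j = begin
  length (sizedSubsets P j (map (false ∷_) A ++ map (true ∷_) A))
    ≡⟨ cong length (trans (cong (filter _) (filter-++ (λ S → T? (P S)) (map (false ∷_) A) _))
                          (filter-++ (λ S → card S ≟ j) (accepted (map (false ∷_) A))
                                                         (accepted (map (true ∷_) A)))) ⟩
  length (sizedSubsets P j (map (false ∷_) A) ++ sizedSubsets P j (map (true ∷_) A))
    ≡⟨ length-++ (sizedSubsets P j (map (false ∷_) A)) ⟩
  length (sizedSubsets P j (map (false ∷_) A)) + length (sizedSubsets P j (map (true ∷_) A))
    ≡⟨ cong₂ _+_ (length-sizedSubsets-map P j false A) (length-sizedSubsets-map P j true A) ⟩
  length (sizedSubsets P₀ j A) + length (filter (λ v → suc (card v) ≟ j) (accepted₁ A))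
    ≡⟨ cong₂ _+_ (length-sizedSubsets n P₀ j) (oneMore j) ⟩
  count (suc n) P j ∎
  where
  open ≡-Reasoning
  A = allSubsets n
  P₀ P₁ : Subset n → Bool
  P₀ v = P (false ∷ v)
  P₁ v = P (true ∷ v)
  accepted : List (Subset (suc n)) → List (Subset (suc n))
  accepted = filter (λ S → T? (P S))
  accepted₁ : List (Subset n) → List (Subset n)
  accepted₁ = filter (λ v → T? (P₁ v))
  none : ∀ xs → length (filter (λ (v : Subset n) → suc (card v) ≟ 0) xs) ≡ 0
  none []       = refl
  none (x ∷ xs) = none xs
  oneMore : ∀ j → length (filter (λ v → suc (card v) ≟ j) (accepted₁ A)) ≡ shift (count n P₁) j
  oneMore zero    = none (accepted₁ A)
  oneMore (suc j) =
    trans (cong length (filter-≐ (λ v → suc (card v) ≟ suc j) (λ v → card v ≟ j)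
                                 (suc-injective , cong suc) (accepted₁ A)))
          (length-sizedSubsets n P₁ j)

s≡count : ∀ G j → s G j ≡ count (nVert G) (isIndependent G) j
s≡count G = length-sizedSubsets (nVert G) (isIndependent G)

≤-maxCard : ∀ {n} j (xs : List (Subset n)) → 0 < length (filter (λ S → card S ≟ j) xs) →
            j ≤ foldr (λ S m → card S ⊔ m) 0 xs
≤-maxCard j (x ∷ xs) pos with card x ≟ j
... | yes refl = m≤m⊔n (card x) _
... | no  c≢j  =
  ≤-trans (≤-maxCard j xs (subst (λ ys → 0 < length ys) (filter-reject (λ S → card S ≟ j) {x} {xs} c≢j) pos))
          (m≤n⊔m (card x) _)

0<s⇒≤α : ∀ G j → 0 < s G j → j ≤ α G
0<s⇒≤α G j = ≤-maxCard j (independentSets G)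

coeff-map-applyUpTo : ∀ (f g : ℕ → ℕ) n j → j < n → coeff (map f (applyUpTo g n)) j ≡ f (g j)
coeff-map-applyUpTo f g (suc n) zero    _         = refl
coeff-map-applyUpTo f g (suc n) (suc j) (s≤s j<n) = coeff-map-applyUpTo f (g ∘ suc) n j j<n

length-indPoly : ∀ G → length (indPoly G) ≡ suc (α G)
length-indPoly G = trans (length-map (s G) (upTo (suc (α G)))) (length-applyUpTo (λ i → i) (suc (α G)))

coeff-indPoly : ∀ G i → i ≤ α G → coeff (indPoly G) i ≡ s G i
coeff-indPoly G i i≤α = coeff-map-applyUpTo (s G) (λ i → i) (suc (α G)) i (s≤s i≤α)

LogConcave⇒s : ∀ G → LogConcave (indPoly G) → ∀ j → 2 + j ≤ α G →
               s G j * s G (2 + j) ≤ s G (1 + j) ^ 2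
LogConcave⇒s G lc j 2+j≤α =
  subst₂ _≤_ (cong₂ _*_ (coeff-s j (m≤n+m j 2)) (coeff-s (2 + j) ≤-refl))
             (cong (_^ 2) (coeff-s (1 + j) (n≤1+n (1 + j))))
         (lc (suc j) (s≤s z≤n) (subst (3 + j ≤_) (sym (length-indPoly G)) (s≤s 2+j≤α)))
  where
  coeff-s : ∀ m → m ≤ 2 + j → coeff (indPoly G) m ≡ s G m
  coeff-s m m≤ = coeff-indPoly G m (≤-trans m≤ 2+j≤α)

-- Independent sets and vertex covers of the tree

edgeAvoided : ∀ {n} → Subset n → ℕ × ℕ → Bool
edgeAvoided S e = not ((proj₁ e ∈ₛ S) ∧ (proj₂ e ∈ₛ S))

independentIn : ∀ {n} → List (ℕ × ℕ) → Subset n → Bool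
independentIn es S = foldr (λ e acc → edgeAvoided S e ∧ acc) true es

isCover : ∀ {n} → List (ℕ × ℕ) → Subset n → Bool
isCover es S = independentIn es (complement S)

independentIn-++ : ∀ {n} xs ys (S : Subset n) →
                   independentIn (xs ++ ys) S ≡ independentIn xs S ∧ independentIn ys S
independentIn-++ []       ys S = refl
independentIn-++ (e ∷ xs) ys S =
  trans (cong (edgeAvoided S e ∧_) (independentIn-++ xs ys S))
        (sym (∧-assoc (edgeAvoided S e) (independentIn xs S) (independentIn ys S)))

∈ₛ-++ˡ : ∀ {m n} (u : Subset m) (w : Subset n) i → i < m → i ∈ₛ (u Vec.++ w) ≡ i ∈ₛ u
∈ₛ-++ˡ (b ∷ u) w zero    _         = refl
∈ₛ-++ˡ (b ∷ u) w (suc i) (s≤s i<m) = ∈ₛ-++ˡ u w i i<m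

∈ₛ-++ʳ : ∀ {m n} (u : Subset m) (w : Subset n) i → (m + i) ∈ₛ (u Vec.++ w) ≡ i ∈ₛ w
∈ₛ-++ʳ []      w i = refl
∈ₛ-++ʳ (b ∷ u) w i = ∈ₛ-++ʳ u w i

pairOk : Bool → Bool → Bool → Bool
pairOk x a b = not (x ∧ a) ∧ not (a ∧ b)

-- w lists the vertices a, b of m pendant paths ab whose common root has membership x
pendantsOk : Bool → (m : ℕ) → Subset (m * 2) → Bool
pendantsOk x zero    []          = true
pendantsOk x (suc m) (a ∷ b ∷ w) = pairOk x a b ∧ pendantsOk x m w

pendantEdges : ℕ → ℕ → List (ℕ × ℕ)
pendantEdges r p = (r , p) ∷ (p , suc p) ∷ []

independentIn-pendants : ∀ {n} r g m (V : Subset n) (w : Subset (m * 2)) →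
  (∀ i → i < m → (g i ∈ₛ V ≡ (i * 2) ∈ₛ w) × (suc (g i) ∈ₛ V ≡ suc (i * 2) ∈ₛ w)) →
  independentIn (concatMap (pendantEdges r) (applyUpTo g m)) V ≡ pendantsOk (r ∈ₛ V) m w
independentIn-pendants r g zero    V []          _   = refl
independentIn-pendants r g (suc m) V (a ∷ b ∷ w) pos =
  trans (cong₂ (λ p q → not (x ∧ p) ∧ (not (p ∧ q) ∧ rest)) (proj₁ first) (proj₂ first))
  (trans (sym (∧-assoc (not (x ∧ a)) (not (a ∧ b)) rest))
         (cong (pairOk x a b ∧_) (independentIn-pendants r (g ∘ suc) m V w (λ i i<m → pos (suc i) (s≤s i<m)))))
  where
  first = pos 0 (s≤s z≤n)
  x = r ∈ₛ V
  rest = independentIn (concatMap (pendantEdges r) (applyUpTo (g ∘ suc) m)) V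

independentIn-pendantP2s : ∀ {n} r o m (V : Subset n) (w : Subset (m * 2)) →
  (∀ j → j < m * 2 → (o + j) ∈ₛ V ≡ j ∈ₛ w) →
  independentIn (pendantP2s r o m) V ≡ pendantsOk (r ∈ₛ V) m w
independentIn-pendantP2s r o m V w at =
  trans (cong (λ es → independentIn es V)
              (trans (sym (concatMap-map (pendantEdges r) position (upTo m)))
                     (cong (concatMap (pendantEdges r)) (map-upTo position m))))
        (independentIn-pendants r position m V w pairAt)
  where
  position : ℕ → ℕ
  position i = o + 2 * i
  pairAt : ∀ i → i < m → (position i ∈ₛ V ≡ (i * 2) ∈ₛ w) × (suc (position i) ∈ₛ V ≡ suc (i * 2) ∈ₛ w)
  pairAt i i<m =
      trans (cong (λ t → (o + t) ∈ₛ V) (*-comm 2 i)) (at (i * 2) (≤-trans (n≤1+n _) 2+2i≤))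
    , trans (cong (_∈ₛ V) (trans (sym (+-suc o (2 * i))) (cong (λ t → o + suc t) (*-comm 2 i))))
            (at (suc (i * 2)) 2+2i≤)
    where 2+2i≤ = *-monoˡ-≤ 2 i<m

headEdges : List (ℕ × ℕ)
headEdges = (0 , 1) ∷ (0 , 2) ∷ (0 , 3) ∷ (1 , 4) ∷ (4 , 5) ∷ (5 , 6) ∷ (6 , 7) ∷ pendantP2s 1 8 2

independentIn-treeG : ∀ k a b c d (u : Subset 8) (w₁ : Subset (k * 2)) (w₂ : Subset ((k + 2) * 2)) →
  independentIn (edges (treeG k)) (a ∷ b ∷ c ∷ d ∷ u Vec.++ (w₁ Vec.++ w₂)) ≡
  independentIn headEdges (a ∷ b ∷ c ∷ d ∷ u) ∧ (pendantsOk c k w₁ ∧ pendantsOk d (k + 2) w₂)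
independentIn-treeG k a b c d u@(_ ∷ _ ∷ _ ∷ _ ∷ _ ∷ _ ∷ _ ∷ _ ∷ []) w₁ w₂ =
  trans (independentIn-++ headEdges (pendantP2s 2 12 k ++ pendantP2s 3 (12 + 2 * k) (k + 2)) V)
        (cong (independentIn headEdges (a ∷ b ∷ c ∷ d ∷ u) ∧_)
              (trans (independentIn-++ (pendantP2s 2 12 k) (pendantP2s 3 (12 + 2 * k) (k + 2)) V)
                     (cong₂ _∧_ (independentIn-pendantP2s 2 12 k V w₁ (∈ₛ-++ˡ w₁ w₂))
                                (independentIn-pendantP2s 3 (12 + 2 * k) (k + 2) V w₂ at₃))))
  where
  V = a ∷ b ∷ c ∷ d ∷ u Vec.++ (w₁ Vec.++ w₂)
  at₃ : ∀ j → j < (k + 2) * 2 → (12 + 2 * k + j) ∈ₛ V ≡ j ∈ₛ w₂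
  at₃ j _ = trans (cong (λ t → (t + j) ∈ₛ (w₁ Vec.++ w₂)) (*-comm 2 k)) (∈ₛ-++ʳ w₁ w₂ j)

pendantsCover : Bool → (m : ℕ) → Subset (m * 2) → Bool
pendantsCover x m w = pendantsOk (not x) m (complement w)

headCover : Bool → Bool → Subset 10 → Bool
headCover c d (a ∷ b ∷ u) = isCover headEdges (a ∷ b ∷ c ∷ d ∷ u)

isCover-treeG : ∀ k c d (v : Subset (10 + (k * 2 + (k + 2) * 2))) →
  isCover (edges (treeG k)) (swapPairs (c ∷ d ∷ v)) ≡
  (headCover c d ⊗ pendantsCover c k ⊗ pendantsCover d (k + 2)) v
isCover-treeG k c d (a ∷ b ∷ v) with Vec.splitAt 8 v
... | u , w , refl with Vec.splitAt (k * 2) w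
... | w₁ , w₂ , refl = begin
  independentIn E (not a ∷ not b ∷ not c ∷ not d ∷ complement (u Vec.++ (w₁ Vec.++ w₂)))
    ≡⟨ cong (λ t → independentIn E (not a ∷ not b ∷ not c ∷ not d ∷ t))
            (trans (Vec.map-++ not u (w₁ Vec.++ w₂)) (cong (complement u Vec.++_) (Vec.map-++ not w₁ w₂))) ⟩
  independentIn E (not a ∷ not b ∷ not c ∷ not d ∷ complement u Vec.++ (complement w₁ Vec.++ complement w₂))
    ≡⟨ independentIn-treeG k (not a) (not b) (not c) (not d) (complement u) (complement w₁) (complement w₂) ⟩
  headCover c d (a ∷ b ∷ u) ∧ (pendantsCover c k w₁ ∧ pendantsCover d (k + 2) w₂)
    ≡⟨ cong (headCover c d (a ∷ b ∷ u) ∧_) (⊗-++ (pendantsCover c k) (pendantsCover d (k + 2)) w₁ w₂) ⟨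
  headCover c d (a ∷ b ∷ u) ∧ (pendantsCover c k ⊗ pendantsCover d (k + 2)) (w₁ Vec.++ w₂)
    ≡⟨ ⊗-++ (headCover c d) (pendantsCover c k ⊗ pendantsCover d (k + 2)) (a ∷ b ∷ u) (w₁ Vec.++ w₂) ⟨
  (headCover c d ⊗ pendantsCover c k ⊗ pendantsCover d (k + 2)) (a ∷ b ∷ u Vec.++ (w₁ Vec.++ w₂)) ∎
  where
  open ≡-Reasoning
  E = edges (treeG k)

pairCover : Bool → Subset 2 → Bool
pairCover x (a ∷ b ∷ []) = pairOk (not x) (not a) (not b)

-- The covers of a pendant path ab: x(2 + x) when its root is covered, x(1 + x) otherwise.
pairPoly : Bool → ℕ → ℕ
pairPoly x zero          = if x then 2 else 1
pairPoly x (suc zero)    = 1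
pairPoly x (suc (suc _)) = 0

count-pairCover : ∀ x → count 2 (pairCover x) ≗ shift (pairPoly x)
count-pairCover true  zero                = refl
count-pairCover true  (suc zero)          = refl
count-pairCover true  (suc (suc zero))    = refl
count-pairCover true  (suc (suc (suc j))) = refl
count-pairCover false zero                = refl
count-pairCover false (suc zero)          = refl
count-pairCover false (suc (suc zero))    = refl
count-pairCover false (suc (suc (suc j))) = refl

pendantPoly : Bool → ℕ → ℕ → ℕ
pendantPoly x zero    = one
pendantPoly x (suc m) = pairPoly x ⊛ pendantPoly x m

count-pendantsCover : ∀ x m → count (m * 2) (pendantsCover x m) ≗ shiftBy m (pendantPoly x m)
count-pendantsCover x zero    j = refl
count-pendantsCover x (suc m) j = begin
  count (2 + m * 2) (pendantsCover x (suc m)) j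
    ≡⟨ count-cong (2 + m * 2) {pendantsCover x (suc m)} {pairCover x ⊗ pendantsCover x m}
                  (λ { (a ∷ b ∷ w) → refl }) j ⟩
  count (2 + m * 2) (pairCover x ⊗ pendantsCover x m) j
    ≡⟨ count-⊗ 2 (pairCover x) (pendantsCover x m) j ⟩
  (count 2 (pairCover x) ⊛ count (m * 2) (pendantsCover x m)) j
    ≡⟨ ⊛-cong (count-pairCover x) (count-pendantsCover x m) j ⟩
  (shift (pairPoly x) ⊛ shiftBy m (pendantPoly x m)) j
    ≡⟨ shift-⊛ (pairPoly x) (shiftBy m (pendantPoly x m)) j ⟩
  shift (pairPoly x ⊛ shiftBy m (pendantPoly x m)) j
    ≡⟨ shift-cong (⊛-shiftBy m (pairPoly x) (pendantPoly x m)) j ⟩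
  shiftBy (suc m) (pendantPoly x (suc m)) j ∎
  where open ≡-Reasoning

tailPoly : ℕ → Bool → Bool → ℕ → ℕ
tailPoly k c d = pendantPoly c k ⊛ pendantPoly d (k + 2)

headCount : Bool → Bool → ℕ → ℕ
headCount c d = count 10 (headCover c d)

-- coverPoly k i is the number of vertex covers of treeG k of size i + 2k + 2
-- (the pendant paths at v₂ and v₃ alone need 2k + 2 cover vertices).
coverPoly : ℕ → ℕ → ℕ
coverPoly k = bitSum (λ c → bitSum (λ d → headCount c d ⊛ tailPoly k c d))

count-coversGiven₂₃ : ∀ k c d →
  count (2 + (8 + (k * 2 + (k + 2) * 2))) (λ v → isCover (edges (treeG k)) (swapPairs (c ∷ d ∷ v))) ≗
  headCount c d ⊛ shiftBy k (shiftBy (k + 2) (tailPoly k c d))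
count-coversGiven₂₃ k c d j = begin
  count (2 + (8 + (k * 2 + (k + 2) * 2))) (λ v → isCover (edges (treeG k)) (swapPairs (c ∷ d ∷ v))) j
    ≡⟨ count-cong (2 + (8 + (k * 2 + (k + 2) * 2))) (isCover-treeG k c d) j ⟩
  count (2 + (8 + (k * 2 + (k + 2) * 2))) (headCover c d ⊗ pendants) j
    ≡⟨ count-⊗ 10 (headCover c d) pendants j ⟩
  (headCount c d ⊛ count (k * 2 + (k + 2) * 2) pendants) j
    ≡⟨ ⊛-cong (λ _ → refl) pendantsCount j ⟩
  (headCount c d ⊛ shiftBy k (shiftBy (k + 2) (tailPoly k c d))) j ∎
  where
  open ≡-Reasoning
  pendants = pendantsCover c k ⊗ pendantsCover d (k + 2)
  pendantsCount : count (k * 2 + (k + 2) * 2) pendants ≗ shiftBy k (shiftBy (k + 2) (tailPoly k c d))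
  pendantsCount i = begin
    count (k * 2 + (k + 2) * 2) pendants i
      ≡⟨ count-⊗ (k * 2) (pendantsCover c k) (pendantsCover d (k + 2)) i ⟩
    (count (k * 2) (pendantsCover c k) ⊛ count ((k + 2) * 2) (pendantsCover d (k + 2))) i
      ≡⟨ ⊛-cong (count-pendantsCover c k) (count-pendantsCover d (k + 2)) i ⟩
    (shiftBy k (pendantPoly c k) ⊛ shiftBy (k + 2) (pendantPoly d (k + 2))) i
      ≡⟨ shiftBy-⊛ k (pendantPoly c k) _ i ⟩
    shiftBy k (pendantPoly c k ⊛ shiftBy (k + 2) (pendantPoly d (k + 2))) i
      ≡⟨ shiftBy-cong k (⊛-shiftBy (k + 2) (pendantPoly c k) (pendantPoly d (k + 2))) i ⟩
    shiftBy k (shiftBy (k + 2) (tailPoly k c d)) i ∎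

-- Every step keeps the length and the predicate of the large count syntactically fixed:
-- a conversion check between differently written counts of length 16 + 4k would unfold
-- all 2^16 branches of count.
s≡coverPoly : ∀ k e c → e + c ≡ 12 → s (treeG k) (e + 2 * k) ≡ coverPoly k (2 + c)
s≡coverPoly k e c e+c≡12 = begin
  s (treeG k) (e + 2 * k)
    ≡⟨ s≡count (treeG k) (e + 2 * k) ⟩
  count (nVert (treeG k)) (isIndependent (treeG k)) (e + 2 * k)
    ≡⟨ count-complement (nVert (treeG k)) (isIndependent (treeG k)) sizes ⟩
  count (nVert (treeG k)) (λ v → isIndependent (treeG k) (complement v)) (2 + c + N)
    ≡⟨ count-cong (nVert (treeG k)) {λ v → isIndependent (treeG k) (complement v)} {isCover E}
                  (λ _ → refl) (2 + c + N) ⟩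
  count (nVert (treeG k)) (isCover E) (2 + c + N)
    ≡⟨ cong (λ n → count n (isCover E) (2 + c + N)) lengths ⟩
  count (4 + (8 + M)) (isCover E) (2 + c + N)
    ≡⟨ count-swapPairs (8 + M) (isCover E) (2 + c + N) ⟩
  bitSum (λ c → bitSum (λ d → count (2 + (8 + M)) (λ v → isCover E (swapPairs (c ∷ d ∷ v))))) (2 + c + N)
    ≡⟨ bitSum-cong (λ c → bitSum-cong (λ d → count-coversGiven₂₃ k c d)) (2 + c + N) ⟩
  bitSum (λ c → bitSum (λ d → headCount c d ⊛ shiftBy k (shiftBy (k + 2) (tailPoly k c d)))) (2 + c + N)
    ≡⟨ bitSum²-+ N {λ c d → headCount c d ⊛ shiftBy k (shiftBy (k + 2) (tailPoly k c d))}
                 (λ c d → ⊛-shiftBy²-+ k (k + 2) (headCount c d) (tailPoly k c d)) c ⟩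
  coverPoly k (2 + c) ∎
  where
  open ≡-Reasoning
  E = edges (treeG k)
  N = k + (k + 2)
  M = k * 2 + (k + 2) * 2
  sizes : e + 2 * k + (2 + c + N) ≡ 16 + 4 * k
  sizes = trans (arith e c k) (cong (_+ (4 + 4 * k)) e+c≡12)
    where arith : ∀ e c k → e + 2 * k + (2 + c + (k + (k + 2))) ≡ e + c + (4 + 4 * k)
          arith = solve-∀
  lengths : nVert (treeG k) ≡ 4 + (8 + M)
  lengths = arith k
    where arith : ∀ k → 16 + 4 * k ≡ 4 + (8 + (k * 2 + (k + 2) * 2))
          arith = solve-∀

-- The coefficients 1, 17, 36 and 13 are numbers of covers of the ten head vertices,
-- found by evaluating headCount.
module _ (k : ℕ) where
  private
    R = tailPoly k

  coverPoly-5 : coverPoly k 5 ≡ 1 * R false false 0 + 0 + 0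
  coverPoly-5 = refl

  coverPoly-6 : coverPoly k 6 ≡ 1 * R false false 1 + 17 * R false false 0 + 1 * R false true 0
                               + (1 * R true false 0 + 0)
  coverPoly-6 = refl

  coverPoly-7 : coverPoly k 7 ≡ 1 * R false false 2 + (17 * R false false 1 + 36 * R false false 0)
                               + (1 * R false true 1 + 17 * R false true 0)
                               + (1 * R true false 1 + 17 * R true false 0 + 13 * R true true 0)
  coverPoly-7 = refl

pendantPoly-false-0 : ∀ m → pendantPoly false m 0 ≡ 1
pendantPoly-false-0 zero    = refl
pendantPoly-false-0 (suc m) = trans (+-identityʳ _) (pendantPoly-false-0 m)

pendantPoly-false-1 : ∀ m → pendantPoly false m 1 ≡ m
pendantPoly-false-1 zero    = refl
pendantPoly-false-1 (suc m) =
  trans (cong₂ (λ a b → 1 * a + 1 * b) (pendantPoly-false-1 m) (pendantPoly-false-0 m)) (arith m)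
  where arith : ∀ m → 1 * m + 1 * 1 ≡ suc m
        arith = solve-∀

pendantPoly-true-0 : ∀ m → pendantPoly true m 0 ≡ 2 ^ m
pendantPoly-true-0 zero    = refl
pendantPoly-true-0 (suc m) = cong (2 *_) (pendantPoly-true-0 m)

pendantPoly-true-0-+2 : ∀ m → pendantPoly true (m + 2) 0 ≡ 4 * 2 ^ m
pendantPoly-true-0-+2 m =
  trans (pendantPoly-true-0 (m + 2)) (trans (^-distribˡ-+-* 2 m 2) (*-comm (2 ^ m) 4))

s-top₁-formula : ℕ → ℕ → ℕ
s-top₁-formula k T = 2 * k + 19 + 5 * T

s-top₂-lowerBound : ℕ → ℕ → ℕ
s-top₂-lowerBound k T = 34 * k + 70 + (4 * k + 85) * T + 52 * (T * T)

s-top₀ : ∀ k → s (treeG k) (9 + 2 * k) ≡ 1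
s-top₀ k = trans (s≡coverPoly k 9 3 refl) (trans (coverPoly-5 k)
  (cong (λ a → 1 * a + 0 + 0) (cong₂ _*_ (pendantPoly-false-0 k) (pendantPoly-false-0 (k + 2)))))

-- In the helpers values, aᵢ, bᵢ, cᵢ, dᵢ stand for the coefficients of pendantPoly false k,
-- pendantPoly false (k + 2), pendantPoly true k and pendantPoly true (k + 2).
s-top₁ : ∀ k → s (treeG k) (8 + 2 * k) ≡ s-top₁-formula k (2 ^ k)
s-top₁ k = trans (s≡coverPoly k 8 4 refl) (trans (coverPoly-6 k)
  (values (pendantPoly-false-0 k) (pendantPoly-false-1 k) (pendantPoly-false-0 (k + 2))
          (pendantPoly-false-1 (k + 2)) (pendantPoly-true-0 k) (pendantPoly-true-0-+2 k)))
  where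
  values : ∀ {T a₀ a₁ b₀ b₁ c₀ d₀} → a₀ ≡ 1 → a₁ ≡ k → b₀ ≡ 1 → b₁ ≡ k + 2 → c₀ ≡ T → d₀ ≡ 4 * T →
    1 * (a₀ * b₁ + a₁ * b₀) + 17 * (a₀ * b₀) + 1 * (a₀ * d₀) + (1 * (c₀ * b₀) + 0) ≡ s-top₁-formula k T
  values {T} refl refl refl refl refl refl = arith k T
    where arith : ∀ k T → 1 * (1 * (k + 2) + k * 1) + 17 * (1 * 1) + 1 * (1 * (4 * T)) + (1 * (T * 1) + 0) ≡
                          2 * k + 19 + 5 * T
          arith = solve-∀

s-top₂ : ∀ k → s-top₂-lowerBound k (2 ^ k) ≤ s (treeG k) (7 + 2 * k)
s-top₂ k =
  ≤-trans (values (tailPoly k false false 2) (tailPoly k true false 1) (pendantPoly true (k + 2) 1)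
                  (pendantPoly-false-0 k) (pendantPoly-false-1 k) (pendantPoly-false-0 (k + 2))
                  (pendantPoly-false-1 (k + 2)) (pendantPoly-true-0 k) (pendantPoly-true-0-+2 k))
          (≤-reflexive (sym (trans (s≡coverPoly k 7 5 refl) (coverPoly-7 k))))
  where
  values : ∀ {T a₀ a₁ b₀ b₁ c₀ d₀} x y d₁ → a₀ ≡ 1 → a₁ ≡ k → b₀ ≡ 1 → b₁ ≡ k + 2 → c₀ ≡ T → d₀ ≡ 4 * T →
    s-top₂-lowerBound k T ≤
      1 * x + (17 * (a₀ * b₁ + a₁ * b₀) + 36 * (a₀ * b₀)) + (1 * (a₀ * d₁ + a₁ * d₀) + 17 * (a₀ * d₀))
      + (1 * y + 17 * (c₀ * b₀) + 13 * (c₀ * d₀))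
  values {T} x y d₁ refl refl refl refl refl refl =
    ≤-trans (m≤m+n (s-top₂-lowerBound k T) (x + y + d₁)) (≤-reflexive (arith k T x y d₁))
    where
    arith : ∀ k T x y d₁ →
      34 * k + 70 + (4 * k + 85) * T + 52 * (T * T) + (x + y + d₁) ≡
      1 * x + (17 * (1 * (k + 2) + k * 1) + 36 * (1 * 1)) + (1 * (1 * d₁ + k * (4 * T)) + 17 * (1 * (4 * T)))
      + (1 * y + 17 * (T * 1) + 13 * (T * (4 * T)))
    arith = solve-∀

n<2^n : ∀ n → n < 2 ^ n
n<2^n zero    = s≤s z≤n
n<2^n (suc n) = ≤-trans (≤-reflexive (+-comm 1 (suc n)))
                        (+-mono-≤ (n<2^n n) (≤-trans (s≤s z≤n) (≤-trans (n<2^n n) (m≤m+n (2 ^ n) 0))))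

8+8r≤2^[3+r] : ∀ r → 8 * suc r ≤ 2 ^ (3 + r)
8+8r≤2^[3+r] r = ≤-trans (*-monoʳ-≤ 8 (n<2^n r)) (≤-reflexive (eight (2 ^ r)))
  where eight : ∀ x → 8 * x ≡ 2 * (2 * (2 * x))
        eight = solve-∀

s-top₁-formula²<s-top₂-lowerBound : ∀ r T → 8 * suc r ≤ T →
                                    s-top₁-formula (3 + r) T ^ 2 < s-top₂-lowerBound (3 + r) T
s-top₁-formula²<s-top₂-lowerBound r T 8+8r≤T with m≤n⇒∃[o]m+o≡n 8+8r≤T
... | q , refl = ≤-trans (s≤s (m≤m+n _ _)) (≤-reflexive (sym (gap r q)))
  where
  -- the difference, as a polynomial in r and q, has positive coefficients
  gap : ∀ r q →
    34 * (3 + r) + 70 + (4 * (3 + r) + 85) * (8 * suc r + q) + 52 * ((8 * suc r + q) * (8 * suc r + q)) ≡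
    suc ((2 * (3 + r) + 19 + 5 * (8 * suc r + q)) * ((2 * (3 + r) + 19 + 5 * (8 * suc r + q)) * 1)
         + (50 + 279 * q + 27 * (q * q) + 2038 * r + 416 * (r * q) + 1596 * (r * r)))
  gap = solve-∀

LogConcave⇒s-top₂-lowerBound≤s-top₁-formula² :
  ∀ k → LogConcave (indPoly (treeG k)) → s-top₂-lowerBound k (2 ^ k) ≤ s-top₁-formula k (2 ^ k) ^ 2
LogConcave⇒s-top₂-lowerBound≤s-top₁-formula² k lc = begin
  s-top₂-lowerBound k (2 ^ k)                       ≡⟨ *-identityʳ _ ⟨
  s-top₂-lowerBound k (2 ^ k) * 1                   ≤⟨ *-mono-≤ (s-top₂ k) (≤-reflexive (sym (s-top₀ k))) ⟩
  s (treeG k) (7 + 2 * k) * s (treeG k) (9 + 2 * k) ≤⟨ LogConcave⇒s (treeG k) lc (7 + 2 * k) 9+2k≤α ⟩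
  s (treeG k) (8 + 2 * k) ^ 2                       ≡⟨ cong (_^ 2) (s-top₁ k) ⟩
  s-top₁-formula k (2 ^ k) ^ 2                      ∎
  where
  open ≤-Reasoning
  9+2k≤α : 9 + 2 * k ≤ α (treeG k)
  9+2k≤α = 0<s⇒≤α (treeG k) (9 + 2 * k) (≤-reflexive (sym (s-top₀ k)))

notLogConcave-3+ : ∀ r → ¬ LogConcave (indPoly (treeG (3 + r)))
notLogConcave-3+ r lc =
  <⇒≱ (s-top₁-formula²<s-top₂-lowerBound r (2 ^ (3 + r)) (8+8r≤2^[3+r] r))
      (LogConcave⇒s-top₂-lowerBound≤s-top₁-formula² (3 + r) lc)

-- Transported along 3 + r ≡ k with subst: matching on that equation with `with` makes
-- the type checker run out of memory.
mainTheorem3 : (k : ℕ) → 3 ≤ k → ¬ LogConcave (indPoly (treeG k))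
mainTheorem3 k 3≤k =
  subst (λ n → ¬ LogConcave (indPoly (treeG n))) (proj₂ 3+r≡k) (notLogConcave-3+ (proj₁ 3+r≡k))
  where 3+r≡k = m≤n⇒∃[o]m+o≡n 3≤k
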